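{- Let $p,q\in\mathbb{Z}$, let $(G_n)_{n\ge0}$ be the sequence defined by $G_0=0$, $G_1=1$ and $G_n=pG_{n-1}+qG_{n-2}$ for $n\ge2$, and let $r=p^2+4q\neq0$. (1) For every positive integer $s$ with $s\mid r$ and for all integers $k,n\ge0$, we have $s^kG_n\mid G_{s^kn}$. (2) Suppose that one of the following holds: (a) $p$ is odd, $\gcd(p,q)=1$ and $s$ is a positive integer with $s\mid r$; or (b) $p$ is even, $\gcd(p/2,q)=1$ and $s$ is a positive integer with $s\mid r/4$; or (c) $\gcd(p,q)=1$ and $s\ge3$ is a prime with $s\mid r$. If $3\nmid q+1$ or $3\nmid s$, then for all integers $k,n\ge0$: $s^k\mid n$ if and only if $s^k\mid G_n$.
   Context: For integers $a,b$, $a\mid b$ means there is an integer $c$ with $b=ca$ (in particular $0\mid 0$); $\gcd$ denotes the greatest common divisor. -}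

module Defs where

open import Data.Nat as ℕ using (ℕ; zero; suc)
open import Data.Nat.Primality using (Prime)
open import Data.Integer using (ℤ; +_; _+_; _*_; _/_; _≤_)
open import Data.Integer.Divisibility using (_∣_)
open import Data.Integer.GCD using (gcd)
open import Data.Product using (_×_)
open import Data.Sum using (_⊎_)
open import Relation.Nullary using (¬_)
open import Relation.Binary.PropositionalEquality using (_≡_)

G : ℤ → ℤ → ℕ → ℤ
G p q zero = + 0
G p q (suc zero) = + 1
G p q (suc (suc n)) = p * G p q (suc n) + q * G p q n

disc : ℤ → ℤ → ℤ
disc p q = p * p + + 4 * q

Hyp : ℤ → ℤ → ℕ → Set
Hyp p q s =
    (¬ (+ 2 ∣ p) × gcd p q ≡ + 1 × 1 ℕ.≤ s × + s ∣ disc p q)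
  ⊎ ((+ 2 ∣ p) × gcd (p / + 2) q ≡ + 1 × 1 ℕ.≤ s × + s ∣ (disc p q / + 4))
  ⊎ (gcd p q ≡ + 1 × Prime s × 3 ℕ.≤ s × + s ∣ disc p q)

module Submission where

open import Defs
open import Data.Nat as ℕ using (ℕ)
open import Data.Integer using (ℤ; +_; _+_; _*_; _^_; 0ℤ)
open import Data.Integer.Divisibility using (_∣_)
open import Data.Product using (_×_)
open import Data.Sum using (_⊎_)
open import Function.Bundles using (_⇔_)
open import Relation.Nullary using (¬_)
open import Relation.Binary.PropositionalEquality using (_≡_)

open import Data.Nat using (zero; suc; _<_; _≤_; s≤s; z≤n)
import Data.Nat.Properties as ℕP
import Data.Nat.Divisibility as ℕD
open import Data.Nat.Combinatorics using (_C_; nC1≡n; nCk+nC[k+1]≡[n+1]C[k+1])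
open import Data.Nat.Induction using (<-rec)
open import Data.Nat.Primality using (Prime; prime[2]; prime?; prime⇒irreducible; euclidsLemma)
import Data.Nat.Tactic.RingSolver as ℕSolver
open import Data.Integer using (1ℤ; -_; _-_; ∣_∣; _/_; _%_; NonZero)
import Data.Integer.Properties as ℤP
import Data.Integer.DivMod as ℤDM
import Data.Integer.Coprimality as ℤC
open import Data.Integer.Divisibility.Signed as Signed using (divides) renaming (_∣_ to _∣ₛ_)
open import Data.Integer.GCD using (gcd; gcd-greatest)
open import Data.Integer.Tactic.RingSolver using (solve-∀)
open import Data.Product using (∃-syntax; _,_)
open import Data.Sum using (inj₁; inj₂)
open import Data.Empty using (⊥-elim)
open import Function.Bundles using (mk⇔)
open import Relation.Nullary using (yes; no)
open import Relation.Nullary.Decidable using (from-yes)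
open import Relation.Binary.PropositionalEquality
  using (refl; sym; trans; cong; cong₂; subst; subst₂; module ≡-Reasoning)

-- In ℤ[α], α² = Pα + Q, the α-coefficient of αⁿ is G(P,Q)ₙ, and the
-- α-coefficients of the powers of any element e form (coeff e times) the Lucas sequence
-- of (trace e, −norm e).  For e = αᵐ this is the multiplication formula
-- G_{jm} = G_m·L_j, where L has discriminant G_m²·disc(P,Q).  Divisibility of L_j is read
-- off from the centred sequences H(x,B) = G(2x, B − x²) (roots x ± √B), which satisfy
-- H_{j+1} ≡ (j+1)xʲ (mod B) and a second-order congruence modulo B² involving C(j+1,3).
-- Part (1): for odd s | disc the first congruence (after scaling G by 2) gives s | L_s; for
-- even s, 2 | disc makes p even and 2 | L_2; strong induction on s, then iteration in k.
-- Part (2): each of (a), (b), (c) writes G, or 2ⁿ⁻¹G, as H(x,B) with s | B and s prime to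
-- B − x².  Then H_{sm} = s·H_m·w with w prime to s, using s | C(s,3) when 3 ∤ s; and
-- 3 ∤ q+1 excludes 3 | s because squares prime to 3 are ≡ 1 (mod 3).

infix 4 _≡_mod_

_≡_mod_ : ℤ → ℤ → ℤ → Set
_≡_mod_ a b m = ∃[ k ] a ≡ b + k * m

∣-resp-mod : ∀ {d m a b} → d ∣ₛ m → a ≡ b mod m → d ∣ₛ b → d ∣ₛ a
∣-resp-mod {d} d∣m (k , a≡b+km) d∣b =
  subst (d ∣ₛ_) (sym a≡b+km) (Signed.∣m∣n⇒∣m+n d∣b (Signed.∣n⇒∣m*n k d∣m))

∣-resp-mod⁻ : ∀ {d m a b} → d ∣ₛ m → a ≡ b mod m → d ∣ₛ a → d ∣ₛ b
∣-resp-mod⁻ {d} d∣m (k , a≡b+km) d∣a =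
  Signed.∣m+n∣n⇒∣m (subst (d ∣ₛ_) a≡b+km d∣a) (Signed.∣n⇒∣m*n k d∣m)

record Coprime (i j : ℤ) : Set where
  constructor coprime
  field unit : ∀ {d} → d ∣ₛ i → d ∣ₛ j → d ∣ₛ 1ℤ
open Coprime public

coprime-sym : ∀ {i j} → Coprime i j → Coprime j i
coprime-sym c = coprime λ d∣j d∣i → unit c d∣i d∣j

coprime-∣ˡ : ∀ {d i j} → d ∣ₛ i → Coprime i j → Coprime d j
coprime-∣ˡ d∣i c = coprime λ e∣d e∣j → unit c (Signed.∣-trans e∣d d∣i) e∣j

coprime-∣ʳ : ∀ {d i j} → d ∣ₛ j → Coprime i j → Coprime i d
coprime-∣ʳ d∣j c = coprime-sym (coprime-∣ˡ d∣j (coprime-sym c))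

coprime-divisor : ∀ {i j k} → Coprime i j → i ∣ₛ j * k → i ∣ₛ k
coprime-divisor {i} {j} {k} c i∣jk =
  Signed.∣ᵤ⇒∣ (ℤC.coprime-divisor i j k library-coprime (Signed.∣⇒∣ᵤ i∣jk))
  where
  library-coprime : ℤC.Coprime i j
  library-coprime {d} (d∣i , d∣j) =
    ℕD.∣1⇒≡1 (Signed.∣⇒∣ᵤ {+ d} (unit c (Signed.∣ᵤ⇒∣ {+ d} d∣i) (Signed.∣ᵤ⇒∣ {+ d} d∣j)))

coprime-* : ∀ {i j k} → Coprime i j → Coprime i k → Coprime i (j * k)
coprime-* cij cik = coprime λ d∣i d∣jk → unit cik d∣i (coprime-divisor (coprime-∣ˡ d∣i cij) d∣jk)

coprime-^ : ∀ {i j} n → Coprime i j → Coprime i (j ^ n)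
coprime-^ zero    _ = coprime λ _ d∣1 → d∣1
coprime-^ (suc n) c = coprime-* c (coprime-^ n c)

coprime-^ˡ : ∀ {i j} n → Coprime i j → Coprime (i ^ n) j
coprime-^ˡ n c = coprime-sym (coprime-^ n (coprime-sym c))

coprime-of-sum : ∀ {S a b} → S ∣ₛ a + b → Coprime a b → Coprime S b
coprime-of-sum S∣a+b c = coprime λ d∣S d∣b →
  unit c (Signed.∣m+n∣n⇒∣m (Signed.∣-trans d∣S S∣a+b) d∣b) d∣b

coprime-by-norm : ∀ {S C N y} → S ∣ₛ C → Coprime S N → y * y - C ≡ N → Coprime S y
coprime-by-norm {y = y} S∣C c y²-C≡N = coprime λ d∣S d∣y →
  unit c d∣S (subst (_ ∣ₛ_) y²-C≡N
    (Signed.∣m∣n⇒∣m-n (Signed.∣m⇒∣m*n y d∣y) (Signed.∣-trans d∣S S∣C)))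

gcd≡1⇒coprime : ∀ {i j} → gcd i j ≡ + 1 → Coprime i j
gcd≡1⇒coprime {i} {j} gcd≡1 = coprime λ {d} d∣i d∣j →
  Signed.∣ᵤ⇒∣ {d} (subst (d ∣_) gcd≡1 (gcd-greatest {i} {j} {d} (Signed.∣⇒∣ᵤ d∣i) (Signed.∣⇒∣ᵤ d∣j)))

prime-coprime : ∀ {ℓ i} → Prime ℓ → ¬ (+ ℓ ∣ i) → Coprime i (+ ℓ)
prime-coprime {ℓ} {i} ℓ-prime ℓ∤i = coprime λ {d} d∣i d∣ℓ →
  unit-or-ℓ d∣i (prime⇒irreducible ℓ-prime (Signed.∣⇒∣ᵤ d∣ℓ))
  where
  unit-or-ℓ : ∀ {d} → d ∣ₛ i → ∣ d ∣ ≡ 1 ⊎ ∣ d ∣ ≡ ℓ → d ∣ₛ 1ℤ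
  unit-or-ℓ {d} _   (inj₁ ∣d∣≡1) = Signed.∣ᵤ⇒∣ {d} (subst (ℕD._∣ 1) (sym ∣d∣≡1) ℕD.∣-refl)
  unit-or-ℓ {d} d∣i (inj₂ ∣d∣≡ℓ) = ⊥-elim (ℓ∤i (subst (ℕD._∣ ∣ i ∣) ∣d∣≡ℓ (Signed.∣⇒∣ᵤ d∣i)))

prime-∣-square : ∀ {ℓ i} → Prime ℓ → + ℓ ∣ₛ i * i → + ℓ ∣ₛ i
prime-∣-square {ℓ} {i} ℓ-prime ℓ∣i² with
  euclidsLemma ∣ i ∣ ∣ i ∣ ℓ-prime (subst (ℓ ℕD.∣_) (ℤP.abs-* i i) (Signed.∣⇒∣ᵤ ℓ∣i²))
... | inj₁ ℓ∣i = Signed.∣ᵤ⇒∣ ℓ∣i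
... | inj₂ ℓ∣i = Signed.∣ᵤ⇒∣ ℓ∣i

pos-^ : ∀ s k → (+ s) ^ k ≡ + (s ℕ.^ k)
pos-^ s zero    = refl
pos-^ s (suc k) = trans (cong (+ s *_) (pos-^ s k)) (sym (ℤP.pos-* s (s ℕ.^ k)))

*-/-cancel : ∀ x d → (x * + suc d) / + suc d ≡ x
*-/-cancel x d = ℤP.*-cancelʳ-≡ ((x * D) / D) x D (sym x*D≡q*D)
  where
  D : ℤ
  D = + suc d
  q : ℤ
  q = (x * D) / D
  ρ : ℕ
  ρ = (x * D) % D
  division : x * D ≡ + ρ + q * D
  division = ℤDM.a≡a%n+[a/n]*n (x * D) D
  remainder-multiple : + ρ ≡ (x - q) * D
  remainder-multiple = trans (isolate (+ ρ) (q * D)) (trans (cong (_- q * D) (sym division)) (factor x q D))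
    where
    isolate : ∀ r t → r ≡ r + t - t
    isolate = solve-∀
    factor : ∀ x q D → x * D - q * D ≡ (x - q) * D
    factor = solve-∀
  small-multiple-is-zero : ∀ r → r < suc d → suc d ℕD.∣ r → r ≡ 0
  small-multiple-is-zero zero    _   _ = refl
  small-multiple-is-zero (suc r) r<D D∣r = ⊥-elim (ℕD.>⇒∤ r<D D∣r)
  ρ≡0 : ρ ≡ 0
  ρ≡0 = small-multiple-is-zero ρ (ℤDM.n%d<d (x * D) D)
          (Signed.∣⇒∣ᵤ {D} {+ ρ} (divides (x - q) remainder-multiple))
  x*D≡q*D : x * D ≡ q * D
  x*D≡q*D = trans division (trans (cong (λ r → + r + q * D) ρ≡0) (ℤP.+-identityˡ (q * D)))

squares-mod-3 : ∀ {x} → ¬ (+ 3 ∣ₛ x) → x * x ≡ 1ℤ mod + 3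
squares-mod-3 {x} 3∤x = by-residue (x % + 3) (ℤDM.n%d<d x (+ 3)) (ℤDM.a≡a%n+[a/n]*n x (+ 3))
  where
  t : ℤ
  t = x / + 3
  square-1 : ∀ t → (+ 1 + t * + 3) * (+ 1 + t * + 3) ≡ 1ℤ + (+ 2 * t + + 3 * t * t) * + 3
  square-1 = solve-∀
  square-2 : ∀ t → (+ 2 + t * + 3) * (+ 2 + t * + 3) ≡ 1ℤ + (1ℤ + + 4 * t + + 3 * t * t) * + 3
  square-2 = solve-∀
  by-residue : ∀ ρ → ρ < 3 → x ≡ + ρ + t * + 3 → x * x ≡ 1ℤ mod + 3
  by-residue 0 _ x≡3t = ⊥-elim (3∤x (divides t (trans x≡3t (ℤP.+-identityˡ (t * + 3)))))
  by-residue 1 _ x≡1+3t = + 2 * t + + 3 * t * t , trans (cong₂ _*_ x≡1+3t x≡1+3t) (square-1 t)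
  by-residue 2 _ x≡2+3t = 1ℤ + + 4 * t + + 3 * t * t , trans (cong₂ _*_ x≡2+3t x≡2+3t) (square-2 t)
  by-residue (suc (suc (suc _))) (s≤s (s≤s (s≤s ()))) _

three-∣-successor : ∀ {x y} → Coprime x y → + 3 ∣ₛ x * x + y → + 3 ∣ₛ y + 1ℤ
three-∣-successor {x} {y} x⊥y 3∣x²+y =
  ∣-resp-mod⁻ Signed.∣-refl x²+y≡y+1 3∣x²+y
  where
  3∤1 : ¬ (+ 3 ∣ₛ 1ℤ)
  3∤1 3∣1 with ℕD.∣1⇒≡1 (Signed.∣⇒∣ᵤ {+ 3} {1ℤ} 3∣1)
  ... | ()
  3∤x : ¬ (+ 3 ∣ₛ x)
  3∤x 3∣x = 3∤1 (unit x⊥y 3∣x (Signed.∣m+n∣m⇒∣n 3∣x²+y (Signed.∣m⇒∣m*n x 3∣x)))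
  x²+y≡y+1 : x * x + y ≡ y + 1ℤ mod + 3
  x²+y≡y+1 with squares-mod-3 3∤x
  ... | k , x²≡1+3k = k , trans (cong (_+ y) x²≡1+3k) (regroup y k)
    where
    regroup : ∀ y k → 1ℤ + k * + 3 + y ≡ y + 1ℤ + k * + 3
    regroup = solve-∀

absorption : ∀ n k → suc k ℕ.* (suc n C suc k) ≡ suc n ℕ.* (n C k)
absorption zero zero    = refl
absorption zero (suc k) = ℕP.*-zeroʳ (suc (suc k))
absorption (suc n) zero = begin
  1 ℕ.* (suc (suc n) C 1) ≡⟨ ℕP.*-identityˡ _ ⟩
  suc (suc n) C 1         ≡⟨ nC1≡n (suc (suc n)) ⟩
  suc (suc n)             ≡⟨ sym (ℕP.*-identityʳ (suc (suc n))) ⟩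
  suc (suc n) ℕ.* 1       ∎
  where open ≡-Reasoning
absorption (suc n) (suc k) = begin
  suc (suc k) ℕ.* (suc (suc n) C suc (suc k))
    ≡⟨ cong (suc (suc k) ℕ.*_) (sym (nCk+nC[k+1]≡[n+1]C[k+1] (suc n) (suc k))) ⟩
  suc (suc k) ℕ.* (a ℕ.+ b)
    ≡⟨ split k a b ⟩
  a ℕ.+ (suc k ℕ.* a ℕ.+ suc (suc k) ℕ.* b)
    ≡⟨ cong₂ (λ u v → a ℕ.+ (u ℕ.+ v)) (absorption n k) (absorption n (suc k)) ⟩
  a ℕ.+ (suc n ℕ.* (n C k) ℕ.+ suc n ℕ.* (n C suc k))
    ≡⟨ cong (a ℕ.+_) (sym (ℕP.*-distribˡ-+ (suc n) (n C k) (n C suc k))) ⟩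
  a ℕ.+ suc n ℕ.* (n C k ℕ.+ n C suc k)
    ≡⟨ cong (λ u → a ℕ.+ suc n ℕ.* u) (nCk+nC[k+1]≡[n+1]C[k+1] n k) ⟩
  suc (suc n) ℕ.* a ∎
  where
  open ≡-Reasoning
  a : ℕ
  a = suc n C suc k
  b : ℕ
  b = suc n C suc (suc k)
  split : ∀ k a b → (2 ℕ.+ k) ℕ.* (a ℕ.+ b) ≡ a ℕ.+ ((1 ℕ.+ k) ℕ.* a ℕ.+ (2 ℕ.+ k) ℕ.* b)
  split = ℕSolver.solve-∀

pascalℤ : ∀ n k → + (suc n C suc k) ≡ + (n C k) + + (n C suc k)
pascalℤ n k = trans (cong +_ (sym (nCk+nC[k+1]≡[n+1]C[k+1] n k))) (ℤP.pos-+ (n C k) (n C suc k))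

-- If 3 ∤ s then s | C(s,3), because 3·C(s,3) = s·C(s−1,2).
∣-C3 : ∀ s → ¬ (+ 3 ∣ + s) → + s ∣ₛ + (s C 3)
∣-C3 zero    _   = Signed.∣-refl
∣-C3 (suc n) 3∤s = coprime-divisor (prime-coprime prime[3] 3∤s) s∣3C
  where
  prime[3] : Prime 3
  prime[3] = from-yes (prime? 3)
  s∣3C : + suc n ∣ₛ + 3 * + (suc n C 3)
  s∣3C = divides (+ (n C 2))
    (trans (sym (ℤP.pos-* 3 (suc n C 3)))
      (trans (cong +_ (absorption n 2)) (trans (ℤP.pos-* (suc n) (n C 2)) (ℤP.*-comm (+ suc n) _))))

G-scale : ∀ l a c n → l * G (l * a) (l * l * c) n ≡ l ^ n * G a c n
G-scale l a c zero          = base₀ l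
  where
  base₀ : ∀ l → l * 0ℤ ≡ 1ℤ * 0ℤ
  base₀ = solve-∀
G-scale l a c (suc zero)    = base₁ l
  where
  base₁ : ∀ l → l * 1ℤ ≡ l * 1ℤ * 1ℤ
  base₁ = solve-∀
G-scale l a c (suc (suc n)) = begin
  l * (l * a * G′ (suc n) + l * l * c * G′ n)
    ≡⟨ distribute l a c (G′ (suc n)) (G′ n) ⟩
  l * a * (l * G′ (suc n)) + l * c * (l * (l * G′ n))
    ≡⟨ cong₂ (λ u v → l * a * u + l * c * (l * v)) (G-scale l a c (suc n)) (G-scale l a c n) ⟩
  l * a * (l ^ suc n * G a c (suc n)) + l * c * (l * (l ^ n * G a c n))
    ≡⟨ collect l a c (l ^ n) (G a c (suc n)) (G a c n) ⟩
  l ^ suc (suc n) * (a * G a c (suc n) + c * G a c n) ∎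
  where
  open ≡-Reasoning
  G′ : ℕ → ℤ
  G′ = G (l * a) (l * l * c)
  distribute : ∀ l a c g₁ g₀ → l * (l * a * g₁ + l * l * c * g₀) ≡ l * a * (l * g₁) + l * c * (l * (l * g₀))
  distribute = solve-∀
  collect : ∀ l a c L g₁ g₀ → l * a * (l * L * g₁) + l * c * (l * (L * g₀)) ≡ l * (l * L) * (a * g₁ + c * g₀)
  collect = solve-∀

G-two : ∀ a c → G a c 2 ≡ a
G-two a c = second a c
  where
  second : ∀ a c → a * 1ℤ + c * 0ℤ ≡ a
  second = solve-∀

-- The centred Lucas sequence H(x,B) = G(2x, B − x²), with characteristic roots x ± √B.
H : ℤ → ℤ → ℕ → ℤ
H x B = G (+ 2 * x) (B - x * x)

-- Modulo B both roots are x:  H_{j+1} ≡ (j+1)·xʲ (mod B).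
H-mod-B : ∀ x B j → H x B (suc j) ≡ + suc j * x ^ j mod B
H-mod-B x B zero          = 0ℤ , base₀ B
  where
  base₀ : ∀ B → 1ℤ ≡ 1ℤ * 1ℤ + 0ℤ * B
  base₀ = solve-∀
H-mod-B x B (suc zero)    = 0ℤ , base₁ x B
  where
  base₁ : ∀ x B → + 2 * x * 1ℤ + (B - x * x) * 0ℤ ≡ + 2 * (x * 1ℤ) + 0ℤ * B
  base₁ = solve-∀
H-mod-B x B (suc (suc j)) with H-mod-B x B (suc j) | H-mod-B x B j
... | k₁ , e₁ | k₀ , e₀ =
  + 2 * x * k₁ + (+ suc j * x ^ j + (B - x * x) * k₀) ,
  trans (cong₂ (λ u v → + 2 * x * u + (B - x * x) * v) e₁ e₀) (step x B (+ j) (x ^ j) k₁ k₀)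
  where
  step : ∀ x B J X k₁ k₀ →
    + 2 * x * ((1ℤ + (1ℤ + J)) * (x * X) + k₁ * B) + (B - x * x) * ((1ℤ + J) * X + k₀ * B)
    ≡ (1ℤ + (1ℤ + (1ℤ + J))) * (x * (x * X)) + (+ 2 * x * k₁ + ((1ℤ + J) * X + (B - x * x) * k₀)) * B
  step = solve-∀

C3-pascal : ∀ j → + (suc (suc j) C 3) ≡ + (suc j C 2) + + (suc j C 3)
C3-pascal j = pascalℤ (suc j) 2

C3-pascal² : ∀ j → + (suc (suc (suc j)) C 3) ≡ (+ suc j + + (suc j C 2)) + (+ (suc j C 2) + + (suc j C 3))
C3-pascal² j = trans (pascalℤ (suc (suc j)) 2)
  (cong₂ _+_ (trans (pascalℤ (suc j) 1) (cong (λ n → + n + + (suc j C 2)) (nC1≡n (suc j)))) (C3-pascal j))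

-- The inductive step of the second-order congruence: substitute the congruences for
-- x²H_{j+2}, x²H_{j+1} and H_{j+1} into x²·(2x·H_{j+2} + (B − x²)·H_{j+1}).
-- Here X = xʲ, J = j, c = C(j+1,3), d = C(j+1,2).
H-mod-B²-step : ∀ x B J X c d h₂ h₁ k₁ k₀ l₀ →
  x * x * h₂ ≡ (1ℤ + (1ℤ + J)) * (x * (x * (x * X))) + (d + c) * B * (x * X) + k₁ * (B * B) →
  x * x * h₁ ≡ (1ℤ + J) * (x * (x * X)) + c * B * X + k₀ * (B * B) →
  h₁ ≡ (1ℤ + J) * X + l₀ * B →
  x * x * (+ 2 * x * h₂ + (B - x * x) * h₁)
    ≡ (1ℤ + (1ℤ + (1ℤ + J))) * (x * (x * (x * (x * X)))) + ((1ℤ + J + d) + (d + c)) * B * (x * (x * X))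
      + (+ 2 * x * k₁ + x * x * l₀ - x * x * k₀) * (B * B)
H-mod-B²-step x B J X c d h₂ h₁ k₁ k₀ l₀ e₂ e₁ f₁ = begin
  x * x * (+ 2 * x * h₂ + (B - x * x) * h₁)
    ≡⟨ expand x B h₂ h₁ ⟩
  + 2 * x * (x * x * h₂) + B * x * x * h₁ - x * x * (x * x * h₁)
    ≡⟨ cong₂ (λ u h → + 2 * x * u + B * x * x * h - x * x * (x * x * h₁)) e₂ f₁ ⟩
  + 2 * x * E₂ + B * x * x * ((1ℤ + J) * X + l₀ * B) - x * x * (x * x * h₁)
    ≡⟨ cong (λ v → + 2 * x * E₂ + B * x * x * ((1ℤ + J) * X + l₀ * B) - x * x * v) e₁ ⟩
  + 2 * x * E₂ + B * x * x * ((1ℤ + J) * X + l₀ * B) - x * x * E₁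
    ≡⟨ collect x B J X c d k₁ k₀ l₀ ⟩
  _ ∎
  where
  open ≡-Reasoning
  E₂ : ℤ
  E₂ = (1ℤ + (1ℤ + J)) * (x * (x * (x * X))) + (d + c) * B * (x * X) + k₁ * (B * B)
  E₁ : ℤ
  E₁ = (1ℤ + J) * (x * (x * X)) + c * B * X + k₀ * (B * B)
  expand : ∀ x B h₂ h₁ → x * x * (+ 2 * x * h₂ + (B - x * x) * h₁)
                       ≡ + 2 * x * (x * x * h₂) + B * x * x * h₁ - x * x * (x * x * h₁)
  expand = solve-∀
  collect : ∀ x B J X c d k₁ k₀ l₀ →
    + 2 * x * ((1ℤ + (1ℤ + J)) * (x * (x * (x * X))) + (d + c) * B * (x * X) + k₁ * (B * B))
      + B * x * x * ((1ℤ + J) * X + l₀ * B)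
      - x * x * ((1ℤ + J) * (x * (x * X)) + c * B * X + k₀ * (B * B))
    ≡ (1ℤ + (1ℤ + (1ℤ + J))) * (x * (x * (x * (x * X)))) + ((1ℤ + J + d) + (d + c)) * B * (x * (x * X))
      + (+ 2 * x * k₁ + x * x * l₀ - x * x * k₀) * (B * B)
  collect = solve-∀

H-mod-B² : ∀ x B j →
  x * x * H x B (suc j) ≡ + suc j * x ^ suc (suc j) + + (suc j C 3) * B * x ^ j mod B * B
H-mod-B² x B zero          = 0ℤ , base₀ x B
  where
  base₀ : ∀ x B → x * x * 1ℤ ≡ 1ℤ * (x * (x * 1ℤ)) + 0ℤ * B * 1ℤ + 0ℤ * (B * B)
  base₀ = solve-∀
H-mod-B² x B (suc zero)    = 0ℤ , base₁ x B
  where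
  base₁ : ∀ x B → x * x * (+ 2 * x * 1ℤ + (B - x * x) * 0ℤ)
                ≡ + 2 * (x * (x * (x * 1ℤ))) + 0ℤ * B * (x * 1ℤ) + 0ℤ * (B * B)
  base₁ = solve-∀
H-mod-B² x B (suc (suc j)) with H-mod-B² x B (suc j) | H-mod-B² x B j | H-mod-B x B j
... | k₁ , e₂ | k₀ , e₁ | l₀ , f₁ = K ,
  trans (H-mod-B²-step x B (+ j) (x ^ j) c d (H x B (suc (suc j))) (H x B (suc j)) k₁ k₀ l₀ e₂′ e₁ f₁)
        (cong (λ c → + suc (suc (suc j)) * x ^ suc (suc (suc (suc j))) + c * B * x ^ suc (suc j) + K * (B * B))
              (sym (C3-pascal² j)))
  where
  c : ℤ
  c = + (suc j C 3)
  d : ℤ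
  d = + (suc j C 2)
  K : ℤ
  K = + 2 * x * k₁ + x * x * l₀ - x * x * k₀
  e₂′ : x * x * H x B (suc (suc j)) ≡ + suc (suc j) * x ^ suc (suc (suc j)) + (d + c) * B * x ^ suc j + k₁ * (B * B)
  e₂′ = trans e₂ (cong (λ c → + suc (suc j) * x ^ suc (suc (suc j)) + c * B * x ^ suc j + k₁ * (B * B)) (C3-pascal j))

-- disc(a,c) − a² = 4c: the sequence G(2a, 4c) is the centred sequence H(a, disc(a,c)).
disc-minus-square : ∀ a c → disc a c - a * a ≡ + 2 * + 2 * c
disc-minus-square = quarter
  where
  quarter : ∀ a c → a * a + + 4 * c - a * a ≡ + 2 * + 2 * c
  quarter = solve-∀

-- An odd divisor s of disc(a,c) divides G(a,c)ₛ: scale by 2 to the centred form.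
odd-divisor-of-disc : ∀ a c s′ → Coprime (+ suc s′) (+ 2) → + suc s′ ∣ₛ disc a c →
                      + suc s′ ∣ₛ G a c (suc s′)
odd-divisor-of-disc a c s′ s⊥2 s∣D =
  coprime-divisor (coprime-^ (suc s′) s⊥2) (subst (+ suc s′ ∣ₛ_) (G-scale (+ 2) a c (suc s′)) s∣2G′)
  where
  s∣H : + suc s′ ∣ₛ H a (disc a c) (suc s′)
  s∣H = ∣-resp-mod s∣D (H-mod-B a (disc a c) s′) (Signed.∣m⇒∣m*n (a ^ s′) Signed.∣-refl)
  s∣2G′ : + suc s′ ∣ₛ + 2 * G (+ 2 * a) (+ 2 * + 2 * c) (suc s′)
  s∣2G′ = Signed.∣n⇒∣m*n (+ 2) (subst (λ b → + suc s′ ∣ₛ G (+ 2 * a) b (suc s′)) (disc-minus-square a c) s∣H)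

module QuadraticRing (P Q : ℤ) where

  infix 5 _α+_
  record Elem : Set where
    constructor _α+_
    field
      coeff : ℤ
      const : ℤ
  open Elem public

  infixl 7 _·_
  _·_ : Elem → Elem → Elem
  (g α+ h) · (g′ α+ h′) = P * g * g′ + g * h′ + h * g′ α+ Q * g * g′ + h * h′

  𝟙 α : Elem
  𝟙 = 0ℤ α+ 1ℤ
  α = 1ℤ α+ 0ℤ

  infixr 8 _^ₑ_
  _^ₑ_ : Elem → ℕ → Elem
  e ^ₑ zero  = 𝟙
  e ^ₑ suc n = e · e ^ₑ n

  -- gα + h is a root of X² − trace·X + norm.
  trace norm : Elem → ℤ
  trace (g α+ h) = P * g + + 2 * h
  norm  (g α+ h) = h * h + P * g * h - Q * g * g

  ·-identityˡ : ∀ e → 𝟙 · e ≡ e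
  ·-identityˡ (g α+ h) = cong₂ _α+_ (coeff-identity P g h) (const-identity Q g h)
    where
    coeff-identity : ∀ P g h → P * 0ℤ * g + 0ℤ * h + 1ℤ * g ≡ g
    coeff-identity = solve-∀
    const-identity : ∀ Q g h → Q * 0ℤ * g + 1ℤ * h ≡ h
    const-identity = solve-∀

  ·-assoc : ∀ e f k → (e · f) · k ≡ e · (f · k)
  ·-assoc (a α+ b) (c α+ d) (e α+ f) = cong₂ _α+_ (coeff-assoc P Q a b c d e f) (const-assoc P Q a b c d e f)
    where
    coeff-assoc : ∀ P Q a b c d e f →
      P * (P * a * c + a * d + b * c) * e + (P * a * c + a * d + b * c) * f + (Q * a * c + b * d) * e
      ≡ P * a * (P * c * e + c * f + d * e) + a * (Q * c * e + d * f) + b * (P * c * e + c * f + d * e)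
    coeff-assoc = solve-∀
    const-assoc : ∀ P Q a b c d e f →
      Q * (P * a * c + a * d + b * c) * e + (Q * a * c + b * d) * f
      ≡ Q * a * (P * c * e + c * f + d * e) + b * (Q * c * e + d * f)
    const-assoc = solve-∀

  ^ₑ-+ : ∀ e m n → e ^ₑ (m ℕ.+ n) ≡ e ^ₑ m · e ^ₑ n
  ^ₑ-+ e zero    n = sym (·-identityˡ (e ^ₑ n))
  ^ₑ-+ e (suc m) n = trans (cong (e ·_) (^ₑ-+ e m n)) (sym (·-assoc e (e ^ₑ m) (e ^ₑ n)))

  ^ₑ-* : ∀ e j m → e ^ₑ (j ℕ.* m) ≡ (e ^ₑ m) ^ₑ j
  ^ₑ-* e zero    m = refl
  ^ₑ-* e (suc j) m = trans (^ₑ-+ e m (j ℕ.* m)) (cong (e ^ₑ m ·_) (^ₑ-* e j m))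

  norm-· : ∀ e f → norm (e · f) ≡ norm e * norm f
  norm-· (a α+ b) (c α+ d) = multiplicative P Q a b c d
    where
    multiplicative : ∀ P Q a b c d →
      (Q * a * c + b * d) * (Q * a * c + b * d) + P * (P * a * c + a * d + b * c) * (Q * a * c + b * d)
        - Q * (P * a * c + a * d + b * c) * (P * a * c + a * d + b * c)
      ≡ (b * b + P * a * b - Q * a * a) * (d * d + P * c * d - Q * c * c)
    multiplicative = solve-∀

  norm-^ₑ : ∀ e n → norm (e ^ₑ n) ≡ norm e ^ n
  norm-^ₑ e zero    = norm-𝟙 P Q
    where
    norm-𝟙 : ∀ P Q → 1ℤ * 1ℤ + P * 0ℤ * 1ℤ - Q * 0ℤ * 0ℤ ≡ 1ℤ
    norm-𝟙 = solve-∀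
  norm-^ₑ e (suc n) = trans (norm-· e (e ^ₑ n)) (cong (norm e *_) (norm-^ₑ e n))

  -- Cayley–Hamilton, on α-coefficients: e^{n+2} = trace(e)·e^{n+1} − norm(e)·eⁿ.
  coeff-^ₑ-recurrence : ∀ e n →
    coeff (e ^ₑ suc (suc n)) ≡ trace e * coeff (e ^ₑ suc n) - norm e * coeff (e ^ₑ n)
  coeff-^ₑ-recurrence (u α+ v) n = cayley-hamilton P Q u v (coeff E) (const E)
    where
    E : Elem
    E = (u α+ v) ^ₑ n
    cayley-hamilton : ∀ P Q u v g h →
      P * u * (P * u * g + u * h + v * g) + u * (Q * u * g + v * h) + v * (P * u * g + u * h + v * g)
      ≡ (P * u + + 2 * v) * (P * u * g + u * h + v * g) - (v * v + P * u * v - Q * u * u) * g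
    cayley-hamilton = solve-∀

  coeff-^ₑ : ∀ e n → coeff (e ^ₑ n) ≡ coeff e * G (trace e) (- norm e) n
  coeff-^ₑ e zero = sym (ℤP.*-zeroʳ (coeff e))
  coeff-^ₑ (u α+ v) (suc zero) = first P u v
    where
    first : ∀ P u v → P * u * 0ℤ + u * 1ℤ + v * 0ℤ ≡ u * 1ℤ
    first = solve-∀
  coeff-^ₑ e (suc (suc n)) = begin
    coeff (e ^ₑ suc (suc n))
      ≡⟨ coeff-^ₑ-recurrence e n ⟩
    trace e * coeff (e ^ₑ suc n) - norm e * coeff (e ^ₑ n)
      ≡⟨ cong₂ (λ a b → trace e * a - norm e * b) (coeff-^ₑ e (suc n)) (coeff-^ₑ e n) ⟩
    trace e * (coeff e * L (suc n)) - norm e * (coeff e * L n)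
      ≡⟨ factor (trace e) (norm e) (coeff e) (L (suc n)) (L n) ⟩
    coeff e * (trace e * L (suc n) + - norm e * L n) ∎
    where
    open ≡-Reasoning
    L : ℕ → ℤ
    L = G (trace e) (- norm e)
    factor : ∀ t N u l₁ l₀ → t * (u * l₁) - N * (u * l₀) ≡ u * (t * l₁ + - N * l₀)
    factor = solve-∀

  coeff-α^ : ∀ n → coeff (α ^ₑ n) ≡ G P Q n
  coeff-α^ n = trans (coeff-^ₑ α n)
    (trans (ℤP.*-identityˡ _) (cong₂ (λ a b → G a b n) (trace-α P) (norm-α P Q)))
    where
    trace-α : ∀ P → P * 1ℤ + + 2 * 0ℤ ≡ P
    trace-α = solve-∀
    norm-α : ∀ P Q → - (0ℤ * 0ℤ + P * 1ℤ * 0ℤ - Q * 1ℤ * 1ℤ) ≡ Q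
    norm-α = solve-∀

  G-multiplication : ∀ j m → G P Q (j ℕ.* m) ≡ G P Q m * G (trace (α ^ₑ m)) (- norm (α ^ₑ m)) j
  G-multiplication j m = begin
    G P Q (j ℕ.* m)              ≡⟨ sym (coeff-α^ (j ℕ.* m)) ⟩
    coeff (α ^ₑ (j ℕ.* m))       ≡⟨ cong coeff (^ₑ-* α j m) ⟩
    coeff ((α ^ₑ m) ^ₑ j)        ≡⟨ coeff-^ₑ (α ^ₑ m) j ⟩
    coeff (α ^ₑ m) * L j         ≡⟨ cong (_* L j) (coeff-α^ m) ⟩
    G P Q m * L j                ∎
    where
    open ≡-Reasoning
    L : ℕ → ℤ
    L = G (trace (α ^ₑ m)) (- norm (α ^ₑ m))

  disc-trace-norm : ∀ e → disc (trace e) (- norm e) ≡ coeff e * coeff e * disc P Q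
  disc-trace-norm (g α+ h) = discriminant P Q g h
    where
    discriminant : ∀ P Q g h →
      (P * g + + 2 * h) * (P * g + + 2 * h) + + 4 * - (h * h + P * g * h - Q * g * g)
      ≡ g * g * (P * P + + 4 * Q)
    discriminant = solve-∀

iterate-multiple : ∀ (F : ℕ → ℤ) s → (∀ m → + s * F m ∣ₛ F (s ℕ.* m)) →
                   ∀ k m → (+ s) ^ k * F m ∣ₛ F (s ℕ.^ k ℕ.* m)
iterate-multiple F s step zero    m =
  Signed.∣-reflexive (trans (ℤP.*-identityˡ (F m)) (cong F (sym (ℕP.*-identityˡ m))))
iterate-multiple F s step (suc k) m =
  subst₂ _∣ₛ_ (sym (ℤP.*-assoc (+ s) ((+ s) ^ k) (F m))) (cong F (sym (ℕP.*-assoc s (s ℕ.^ k) m)))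
    (Signed.∣-trans (Signed.*-monoʳ-∣ (+ s) (iterate-multiple F s step k m)) (step (s ℕ.^ k ℕ.* m)))

module Part1 (p q : ℤ) where
  open QuadraticRing p q

  divides-multiple : ∀ j m {d} → d ∣ₛ G (trace (α ^ₑ m)) (- norm (α ^ₑ m)) j →
                     d * G p q m ∣ₛ G p q (j ℕ.* m)
  divides-multiple j m {d} d∣L =
    subst₂ _∣ₛ_ (ℤP.*-comm (G p q m) d) (sym (G-multiplication j m)) (Signed.*-monoʳ-∣ (G p q m) d∣L)

  odd-multiple : ∀ s′ m → Coprime (+ suc s′) (+ 2) → + suc s′ ∣ₛ disc p q →
                 + suc s′ * G p q m ∣ₛ G p q (suc s′ ℕ.* m)
  odd-multiple s′ m s⊥2 s∣r = divides-multiple (suc s′) m (odd-divisor-of-disc _ _ s′ s⊥2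
    (subst (_ ∣ₛ_) (sym (disc-trace-norm (α ^ₑ m))) (Signed.∣n⇒∣m*n (coeff (α ^ₑ m) * coeff (α ^ₑ m)) s∣r)))

  -- If 2 | disc then p is even, hence so is trace αᵐ, and 2·G_m | G_{2m}.
  even-multiple : ∀ m → + 2 ∣ₛ disc p q → + 2 * G p q m ∣ₛ G p q (2 ℕ.* m)
  even-multiple m 2∣r = divides-multiple 2 m (subst (+ 2 ∣ₛ_) (sym (G-two (trace (α ^ₑ m)) (- norm (α ^ₑ m)))) 2∣trace)
    where
    2∣p : + 2 ∣ₛ p
    2∣p = prime-∣-square prime[2] (Signed.∣m+n∣n⇒∣m 2∣r (Signed.∣m⇒∣m*n q (divides (+ 2) refl)))
    2∣trace : + 2 ∣ₛ trace (α ^ₑ m)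
    2∣trace = Signed.∣m∣n⇒∣m+n (Signed.∣m⇒∣m*n _ 2∣p) (Signed.∣m⇒∣m*n _ Signed.∣-refl)

  doubling : ∀ t m → + t * G p q m ∣ₛ G p q (t ℕ.* m) → + 2 ∣ₛ disc p q →
             + (t ℕ.* 2) * G p q m ∣ₛ G p q (t ℕ.* 2 ℕ.* m)
  doubling t m t·G∣G 2∣r = subst₂ _∣ₛ_ coefficient index
    (Signed.∣-trans (Signed.*-monoʳ-∣ (+ 2) t·G∣G) (even-multiple (t ℕ.* m) 2∣r))
    where
    coefficient : + 2 * (+ t * G p q m) ≡ + (t ℕ.* 2) * G p q m
    coefficient = trans (sym (ℤP.*-assoc (+ 2) (+ t) (G p q m)))
      (cong (_* G p q m) (trans (ℤP.*-comm (+ 2) (+ t)) (sym (ℤP.pos-* t 2))))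
    index : G p q (2 ℕ.* (t ℕ.* m)) ≡ G p q (t ℕ.* 2 ℕ.* m)
    index = cong (G p q) (trans (sym (ℕP.*-assoc 2 t m)) (cong (ℕ._* m) (ℕP.*-comm 2 t)))

  divisor-multiple : ∀ s → 1 ≤ s → + s ∣ₛ disc p q → ∀ m → + s * G p q m ∣ₛ G p q (s ℕ.* m)
  divisor-multiple = <-rec _ step
    where
    step : ∀ s → (∀ {t} → t < s → 1 ≤ t → + t ∣ₛ disc p q → ∀ m → + t * G p q m ∣ₛ G p q (t ℕ.* m)) →
           1 ≤ s → + s ∣ₛ disc p q → ∀ m → + s * G p q m ∣ₛ G p q (s ℕ.* m)
    step (suc s′) rec _ s∣r m with 2 ℕD.∣? suc s′
    ... | no 2∤s = odd-multiple s′ m (prime-coprime prime[2] 2∤s) s∣r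
    ... | yes (ℕD.divides (suc t′) s≡t*2) =
      subst (λ s → + s * G p q m ∣ₛ G p q (s ℕ.* m)) (sym s≡t*2) (doubling t m (rec t<s (s≤s z≤n) t∣r m) 2∣r)
      where
      t : ℕ
      t = suc t′
      t*2∣r : + (t ℕ.* 2) ∣ₛ disc p q
      t*2∣r = subst (λ s → + s ∣ₛ disc p q) s≡t*2 s∣r
      t∣r : + t ∣ₛ disc p q
      t∣r = Signed.∣-trans (divides (+ 2) (trans (ℤP.pos-* t 2) (ℤP.*-comm (+ t) (+ 2)))) t*2∣r
      2∣r : + 2 ∣ₛ disc p q
      2∣r = Signed.∣-trans (divides (+ t) (ℤP.pos-* t 2)) t*2∣r
      t<s : t < suc s′
      t<s = subst (t <_) (sym s≡t*2) (ℕP.m<m*n t 2 (s≤s (s≤s z≤n)))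

  power-multiple : ∀ s → 1 ≤ s → + s ∣ₛ disc p q → ∀ k n → (+ s) ^ k * G p q n ∣ₛ G p q (s ℕ.^ k ℕ.* n)
  power-multiple s 1≤s s∣r = iterate-multiple (G p q) s (divisor-multiple s 1≤s s∣r)

-- Part (2): s^k | n ⇔ s^k | H_n for centred sequences

cofactor-coprime : ∀ {S y w c D} j .{{_ : NonZero S}} → S ∣ₛ c → S ∣ₛ D → Coprime S y →
                   y * y * (w * S) ≡ S * y ^ suc (suc j) + c * D * y ^ j mod D * D → Coprime w S
cofactor-coprime {S} {y} {w} {c} {D} j (divides γ c≡γS) (divides δ D≡δS) S⊥y (k , second-order) =
  coprime λ d∣w d∣S → unit (coprime-^ (suc (suc j)) S⊥y) d∣S
    (∣-resp-mod⁻ d∣S reduced (Signed.∣n⇒∣m*n (y * y) d∣w))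
  where
  Y₂ : ℤ
  Y₂ = y ^ suc (suc j)
  Y : ℤ
  Y = y ^ j
  reduced : y * y * w ≡ Y₂ mod S
  reduced = γ * δ * Y + k * δ * δ , ℤP.*-cancelˡ-≡ S _ _ (begin
    S * (y * y * w)                              ≡⟨ commute S y w ⟩
    y * y * (w * S)                              ≡⟨ second-order ⟩
    S * Y₂ + c * D * Y + k * (D * D)             ≡⟨ cong₂ (λ a b → S * Y₂ + a * b * Y + k * (b * b)) c≡γS D≡δS ⟩
    S * Y₂ + γ * S * (δ * S) * Y + k * (δ * S * (δ * S))
                                                 ≡⟨ factor S Y₂ Y γ δ k ⟩
    S * (Y₂ + (γ * δ * Y + k * δ * δ) * S)   ∎)
    where
    open ≡-Reasoning
    commute : ∀ S y w → S * (y * y * w) ≡ y * y * (w * S)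
    commute = solve-∀
    factor : ∀ S Y₂ Y γ δ k → S * Y₂ + γ * S * (δ * S) * Y + k * (δ * S * (δ * S))
                              ≡ S * (Y₂ + (γ * δ * Y + k * δ * δ) * S)
    factor = solve-∀

module Centred (x B : ℤ) where
  open QuadraticRing (+ 2 * x) (B - x * x)

  -- αᵐ = H_m·α + h_m has half-trace x·H_m + h_m.
  half-trace : ℕ → ℤ
  half-trace m = x * H x B m + const (α ^ₑ m)

  private
    trace-centred : ∀ x g h → + 2 * x * g + + 2 * h ≡ + 2 * (x * g + h)
    trace-centred = solve-∀
    norm-centred : ∀ x B g h → h * h + + 2 * x * g * h - (B - x * x) * g * g
                               ≡ (x * g + h) * (x * g + h) - B * (g * g)
    norm-centred = solve-∀

  H-multiplication : ∀ j m → H x B (j ℕ.* m) ≡ H x B m * H (half-trace m) (B * (H x B m * H x B m)) j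
  H-multiplication j m = trans (G-multiplication j m)
    (cong (H x B m *_) (cong₂ (λ a b → G a b j) trace≡ (trans (cong -_ norm≡) (negate _ (B * (H x B m * H x B m))))))
    where
    g : ℤ
    g = coeff (α ^ₑ m)
    h : ℤ
    h = const (α ^ₑ m)
    trace≡ : trace (α ^ₑ m) ≡ + 2 * half-trace m
    trace≡ = trans (trace-centred x g h) (cong (λ g → + 2 * (x * g + h)) (coeff-α^ m))
    norm≡ : norm (α ^ₑ m) ≡ half-trace m * half-trace m - B * (H x B m * H x B m)
    norm≡ = trans (norm-centred x B g h) (cong (λ g → (x * g + h) * (x * g + h) - B * (g * g)) (coeff-α^ m))
    negate : ∀ a b → - (a - b) ≡ b - a
    negate = solve-∀

  -- x_m² − B·H_m² = (x² − B)ᵐ, the norm of αᵐ.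
  half-trace-norm : ∀ m → half-trace m * half-trace m - B * (H x B m * H x B m) ≡ (x * x - B) ^ m
  half-trace-norm m = begin
    half-trace m * half-trace m - B * (H x B m * H x B m)
      ≡⟨ cong (λ g → (x * g + h) * (x * g + h) - B * (g * g)) (sym (coeff-α^ m)) ⟩
    (x * g + h) * (x * g + h) - B * (g * g)   ≡⟨ sym (norm-centred x B g h) ⟩
    norm (α ^ₑ m)                              ≡⟨ norm-^ₑ α m ⟩
    norm α ^ m                                 ≡⟨ cong (_^ m) (norm-α x B) ⟩
    (x * x - B) ^ m                            ∎
    where
    open ≡-Reasoning
    g : ℤ
    g = coeff (α ^ₑ m)
    h : ℤ
    h = const (α ^ₑ m)
    norm-α : ∀ x B → 0ℤ * 0ℤ + + 2 * x * 1ℤ * 0ℤ - (B - x * x) * 1ℤ * 1ℤ ≡ x * x - B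
    norm-α = solve-∀

module Valuation (x B : ℤ) (s′ : ℕ) (s∣B : + suc s′ ∣ₛ B) (s⊥Q : Coprime (+ suc s′) (B - x * x))
                 (3∤s : ¬ (+ 3 ∣ + suc s′)) where
  open Centred x B

  s : ℕ
  s = suc s′

  S : ℤ
  S = + s

  s⊥x²-B : Coprime S (x * x - B)
  s⊥x²-B = coprime λ d∣S d∣x²-B → unit s⊥Q d∣S (subst (_ ∣ₛ_) (negate x B) (Signed.∣m⇒∣-m d∣x²-B))
    where
    negate : ∀ x B → - (x * x - B) ≡ B - x * x
    negate = solve-∀

  s⊥x : Coprime S x
  s⊥x = coprime-by-norm s∣B s⊥x²-B refl

  s⊥half-trace : ∀ m → Coprime S (half-trace m)
  s⊥half-trace m = coprime-by-norm (Signed.∣m⇒∣m*n _ s∣B) (coprime-^ m s⊥x²-B) (half-trace-norm m)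

  divides-index : ∀ n → S ∣ₛ H x B n → S ∣ₛ + n
  divides-index zero    _   = divides 0ℤ refl
  divides-index (suc j) s∣H = coprime-divisor (coprime-^ j s⊥x)
    (subst (S ∣ₛ_) (ℤP.*-comm (+ suc j) (x ^ j)) (∣-resp-mod⁻ s∣B (H-mod-B x B j) s∣H))

  -- Lifting: H_{sm} = s·H_m·w with w prime to s.  Only this property of the cofactor w is
  -- ever used, so the definition is kept opaque (unfolding its proof term is expensive).
  opaque
    lift : ∀ m → ∃[ w ] (H x B (s ℕ.* m) ≡ S * (H x B m * w) × Coprime w S)
    lift m = w , H-sm , cofactor-coprime s′ (∣-C3 s 3∤s) s∣D (s⊥half-trace m) second-order
      where
      y : ℤ
      y = half-trace m
      D : ℤ
      D = B * (H x B m * H x B m)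
      s∣D : S ∣ₛ D
      s∣D = Signed.∣m⇒∣m*n _ s∣B
      s∣L : S ∣ₛ H y D s
      s∣L = ∣-resp-mod s∣D (H-mod-B y D s′) (Signed.∣m⇒∣m*n (y ^ s′) Signed.∣-refl)
      w : ℤ
      w = Signed._∣_.quotient s∣L
      L≡wS : H y D s ≡ w * S
      L≡wS = Signed._∣_.equality s∣L
      H-sm : H x B (s ℕ.* m) ≡ S * (H x B m * w)
      H-sm = trans (H-multiplication s m) (trans (cong (H x B m *_) L≡wS) (rotate (H x B m) w S))
        where
        rotate : ∀ h w S → h * (w * S) ≡ S * (h * w)
        rotate = solve-∀
      second-order : y * y * (w * S) ≡ S * y ^ suc s + + (s C 3) * D * y ^ s′ mod D * D
      second-order = subst (λ L → y * y * L ≡ S * y ^ suc s + + (s C 3) * D * y ^ s′ mod D * D)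
                           L≡wS (H-mod-B² y D s′)

  s-multiple : ∀ m → S * H x B m ∣ₛ H x B (s ℕ.* m)
  s-multiple m with lift m
  ... | w , H-sm , _ = subst (S * H x B m ∣ₛ_) (trans (ℤP.*-assoc S (H x B m) w) (sym H-sm))
                         (Signed.∣m⇒∣m*n w Signed.∣-refl)

  ascend : ∀ k n → S ^ k ∣ₛ + n → S ^ k ∣ₛ H x B n
  ascend k n s^k∣n with subst (ℕD._∣ n) (cong ∣_∣ (pos-^ s k)) (Signed.∣⇒∣ᵤ s^k∣n)
  ... | ℕD.divides t refl =
    subst (λ i → S ^ k ∣ₛ H x B i) (ℕP.*-comm (s ℕ.^ k) t)
      (Signed.∣-trans (Signed.∣m⇒∣m*n (H x B t) Signed.∣-refl) (iterate-multiple (H x B) s s-multiple k t))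

  first-factor : ∀ k {i} → S ^ suc k ∣ₛ i → S ∣ₛ i
  first-factor k = Signed.∣-trans (Signed.∣m⇒∣m*n (S ^ k) Signed.∣-refl)

  descend : ∀ k n → S ^ k ∣ₛ H x B n → S ^ k ∣ₛ + n
  descend zero    n _ = divides (+ n) (sym (ℤP.*-identityʳ (+ n)))
  descend (suc k) n s^k+1∣H with Signed.∣⇒∣ᵤ {S} (divides-index n (first-factor k s^k+1∣H))
  ... | ℕD.divides t refl with lift t
  ... | w , H-st , w⊥s =
    subst (S * S ^ k ∣ₛ_) (trans (sym (ℤP.pos-* s t)) (cong +_ (ℕP.*-comm s t)))
      (Signed.*-monoʳ-∣ S (descend k t s^k∣H))
    where
    s^k∣Hw : S ^ k ∣ₛ H x B t * w
    s^k∣Hw = Signed.*-cancelˡ-∣ S (subst (S * S ^ k ∣ₛ_) (trans (cong (H x B) (ℕP.*-comm t s)) H-st) s^k+1∣H)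
    s^k∣H : S ^ k ∣ₛ H x B t
    s^k∣H = coprime-divisor (coprime-^ˡ k (coprime-sym w⊥s)) (subst (S ^ k ∣ₛ_) (ℤP.*-comm (H x B t) w) s^k∣Hw)

-- Part (2): reducing the hypotheses (a), (b), (c) to centred sequences

Criterion : ℕ → (ℕ → ℤ) → Set
Criterion s F = ∀ k n → ((+ s) ^ k ∣ + n) ⇔ ((+ s) ^ k ∣ F n)

criterion : ∀ {s F} → (∀ k n → (+ s) ^ k ∣ₛ + n → (+ s) ^ k ∣ₛ F n) →
            (∀ k n → (+ s) ^ k ∣ₛ F n → (+ s) ^ k ∣ₛ + n) → Criterion s F
criterion {s} {F} ascend descend k n = mk⇔
  (λ s^k∣n → Signed.∣⇒∣ᵤ (ascend k n (Signed.∣ᵤ⇒∣ {(+ s) ^ k} {+ n} s^k∣n)))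
  (λ s^k∣F → Signed.∣⇒∣ᵤ (descend k n (Signed.∣ᵤ⇒∣ {(+ s) ^ k} {F n} s^k∣F)))

transfer : ∀ {d u v f g} → Coprime d v → u * f ≡ v * g → d ∣ₛ f → d ∣ₛ g
transfer {u = u} d⊥v uf≡vg d∣f = coprime-divisor d⊥v (subst (_ ∣ₛ_) uf≡vg (Signed.∣n⇒∣m*n u d∣f))

coprime-square : ∀ {i j} → Coprime i j → Coprime (i * i) j
coprime-square c = coprime-sym (coprime-* (coprime-sym c) (coprime-sym c))

exclude-three : ∀ {q s} → (¬ (+ 3 ∣ q + + 1) ⊎ ¬ (+ 3 ∣ + s)) → (+ 3 ∣ₛ + s → + 3 ∣ₛ q + 1ℤ) → ¬ (+ 3 ∣ + s)
exclude-three {q} {s} (inj₁ 3∤q+1) forces 3∣s =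
  3∤q+1 (Signed.∣⇒∣ᵤ (forces (Signed.∣ᵤ⇒∣ {+ 3} {+ s} 3∣s)))
exclude-three (inj₂ 3∤s) _ = 3∤s

odd-prime : ∀ {s} → Prime s → 3 ≤ s → ¬ (+ 2 ∣ + s)
odd-prime s-prime 3≤s 2∣s with prime⇒irreducible s-prime 2∣s
... | inj₂ refl with 3≤s
... | s≤s (s≤s ())

disc-even : ∀ {p} c q → p ≡ c * + 2 → disc p q ≡ (c * c + q) * + 4
disc-even c q refl = expand c q
  where
  expand : ∀ c q → c * + 2 * (c * + 2) + + 4 * q ≡ (c * c + q) * + 4
  expand = solve-∀

-- (a) p odd, gcd(p,q) = 1, s | disc:  2·H(p, disc)ₙ = 2ⁿ·Gₙ with s odd.
odd-criterion : ∀ p q s′ → ¬ (+ 2 ∣ p) → Coprime p q → + suc s′ ∣ₛ disc p q →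
                (¬ (+ 3 ∣ q + + 1) ⊎ ¬ (+ 3 ∣ + suc s′)) → Criterion (suc s′) (G p q)
odd-criterion p q s′ p-odd p⊥q s∣r three = criterion
  (λ k n s^k∣n → transfer {u = + 2} (coprime-^ n (coprime-^ˡ k s⊥2)) (scaled n) (ascend k n s^k∣n))
  (λ k n s^k∣G → descend k n (transfer {u = (+ 2) ^ n} (coprime-^ˡ k s⊥2) (sym (scaled n)) s^k∣G))
  where
  S : ℤ
  S = + suc s′
  p⊥4q : Coprime p (+ 2 * + 2 * q)
  p⊥4q = coprime-* (coprime-* p⊥2 p⊥2) p⊥q
    where
    p⊥2 : Coprime p (+ 2)
    p⊥2 = prime-coprime prime[2] p-odd
  s⊥4q : Coprime S (+ 2 * + 2 * q)
  s⊥4q = coprime-of-sum s∣r (coprime-square p⊥4q)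
  s⊥2 : Coprime S (+ 2)
  s⊥2 = coprime-∣ʳ (divides (+ 2 * q) (twice q)) s⊥4q
    where
    twice : ∀ q → + 2 * + 2 * q ≡ + 2 * q * + 2
    twice = solve-∀
  3∤s : ¬ (+ 3 ∣ + suc s′)
  3∤s = exclude-three {q} three λ 3∣s →
    Signed.∣m+n∣n⇒∣m (subst (+ 3 ∣ₛ_) (regroup q) (three-∣-successor p⊥4q (Signed.∣-trans 3∣s s∣r)))
      (Signed.∣n⇒∣m*n q Signed.∣-refl)
    where
    regroup : ∀ q → + 2 * + 2 * q + 1ℤ ≡ q + 1ℤ + q * + 3
    regroup = solve-∀
  open Valuation p (disc p q) s′ s∣r (subst (Coprime S) (sym (disc-minus-square p q)) s⊥4q) 3∤s
  scaled : ∀ n → + 2 * H p (disc p q) n ≡ (+ 2) ^ n * G p q n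
  scaled n = trans (cong (λ c → + 2 * G (+ 2 * p) c n) (disc-minus-square p q)) (G-scale (+ 2) p q n)

-- (b), and (c) with p even:  p = 2c, gcd(c,q) = 1, s | c² + q, and G(p,q) = H(c, c² + q).
even-criterion : ∀ p q c s′ → p ≡ c * + 2 → Coprime c q → + suc s′ ∣ₛ c * c + q →
                 (¬ (+ 3 ∣ q + + 1) ⊎ ¬ (+ 3 ∣ + suc s′)) → Criterion (suc s′) (G p q)
even-criterion p q c s′ p≡c2 c⊥q s∣b three = criterion
  (λ k n s^k∣n → subst (_ ∣ₛ_) (sym (G≡H n)) (ascend k n s^k∣n))
  (λ k n s^k∣G → descend k n (subst (_ ∣ₛ_) (G≡H n) s^k∣G))
  where
  S : ℤ
  S = + suc s′
  cancel : ∀ c q → c * c + q - c * c ≡ q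
  cancel = solve-∀
  s⊥Q : Coprime S (c * c + q - c * c)
  s⊥Q = subst (Coprime S) (sym (cancel c q)) (coprime-of-sum s∣b (coprime-square c⊥q))
  3∤s : ¬ (+ 3 ∣ + suc s′)
  3∤s = exclude-three {q} three λ 3∣s → three-∣-successor c⊥q (Signed.∣-trans 3∣s s∣b)
  open Valuation c (c * c + q) s′ s∣b s⊥Q 3∤s
  G≡H : ∀ n → G p q n ≡ H c (c * c + q) n
  G≡H n = cong₂ (λ a b → G a b n) (trans p≡c2 (ℤP.*-comm c (+ 2))) (sym (cancel c q))

part2 : ∀ p q s → Hyp p q s → (¬ (+ 3 ∣ q + + 1) ⊎ ¬ (+ 3 ∣ + s)) → Criterion s (G p q)
part2 p q zero (inj₁ (_ , _ , () , _))
part2 p q zero (inj₂ (inj₁ (_ , _ , () , _)))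
part2 p q zero (inj₂ (inj₂ (_ , _ , () , _)))
part2 p q (suc s′) (inj₁ (p-odd , gcd≡1 , _ , s∣r)) =
  odd-criterion p q s′ p-odd (gcd≡1⇒coprime gcd≡1) (Signed.∣ᵤ⇒∣ s∣r)
part2 p q (suc s′) (inj₂ (inj₁ (2∣p , gcd≡1 , _ , s∣r/4))) with Signed.∣ᵤ⇒∣ {+ 2} {p} 2∣p
... | divides c p≡c2 = even-criterion p q c s′ p≡c2 (gcd≡1⇒coprime (subst (λ a → gcd a q ≡ + 1) p/2≡c gcd≡1))
                         (subst (+ suc s′ ∣ₛ_) r/4≡c²+q (Signed.∣ᵤ⇒∣ s∣r/4))
  where
  p/2≡c : p / + 2 ≡ c
  p/2≡c = trans (cong (_/ + 2) p≡c2) (*-/-cancel c 1)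
  r/4≡c²+q : disc p q / + 4 ≡ c * c + q
  r/4≡c²+q = trans (cong (_/ + 4) (disc-even c q p≡c2)) (*-/-cancel (c * c + q) 3)
part2 p q (suc s′) (inj₂ (inj₂ (gcd≡1 , s-prime , 3≤s , s∣r))) with 2 ℕD.∣? ∣ p ∣
... | no p-odd = odd-criterion p q s′ p-odd (gcd≡1⇒coprime gcd≡1) (Signed.∣ᵤ⇒∣ s∣r)
... | yes 2∣p with Signed.∣ᵤ⇒∣ {+ 2} {p} 2∣p
... | divides c p≡c2 = even-criterion p q c s′ p≡c2 c⊥q s∣b
  where
  c⊥q : Coprime c q
  c⊥q = coprime-∣ˡ (divides (+ 2) (trans p≡c2 (ℤP.*-comm c (+ 2)))) (gcd≡1⇒coprime gcd≡1)
  s⊥2 : Coprime (+ suc s′) (+ 2)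
  s⊥2 = prime-coprime prime[2] (odd-prime s-prime 3≤s)
  s∣b : + suc s′ ∣ₛ c * c + q
  s∣b = coprime-divisor s⊥2 (coprime-divisor s⊥2
          (subst (+ suc s′ ∣ₛ_) (trans (disc-even c q p≡c2) (quadruple (c * c + q))) (Signed.∣ᵤ⇒∣ s∣r)))
    where
    quadruple : ∀ b → b * + 4 ≡ + 2 * (+ 2 * b)
    quadruple = solve-∀

theorem1p1 : (p q : ℤ) → ¬ (disc p q ≡ 0ℤ) →
    ((s : ℕ) → 1 ℕ.≤ s → + s ∣ disc p q → (k n : ℕ) →
       ((+ s) ^ k * G p q n) ∣ G p q (s ℕ.^ k ℕ.* n))
    × ((s : ℕ) → Hyp p q s → (¬ (+ 3 ∣ q + + 1) ⊎ ¬ (+ 3 ∣ + s)) → (k n : ℕ) →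
       (((+ s) ^ k ∣ + n) ⇔ ((+ s) ^ k ∣ G p q n)))
theorem1p1 p q _ = part1 , part2 p q
  where
  part1 : ∀ s → 1 ℕ.≤ s → + s ∣ disc p q → ∀ k n → ((+ s) ^ k * G p q n) ∣ G p q (s ℕ.^ k ℕ.* n)
  part1 s 1≤s s∣r k n = Signed.∣⇒∣ᵤ (Part1.power-multiple p q s 1≤s (Signed.∣ᵤ⇒∣ s∣r) k n)
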